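{- Let $m,n,k$ be positive integers and let $t_1,\dots,t_m$ be nonnegative integers. Then $$P'(t_1,\ldots,t_m,\underbrace{k,k,\ldots,k}_{n})\equiv P'(t_1,\ldots,t_m)\,P'(\underbrace{k,k,\ldots,k}_{n})\pmod{n}.$$
   Context: $P'(s_1,\dots,s_r)$ is the number of anagrams without fixed letters of the word $1^{s_1}2^{s_2}\cdots r^{s_r}$ (letter $i$ repeated $s_i$ times, in this order), i.e. the number of words $a_{1,1}\ldots a_{1,s_1}\ldots a_{r,1}\ldots a_{r,s_r}$ that are rearrangements of $1^{s_1}\cdots r^{s_r}$ with $a_{i,j}\neq i$ for all $i,j$. -}

module Defs where

open import Data.Nat using (ℕ; zero; suc; _≡ᵇ_)
open import Data.Bool using (Bool; true; false; not; _∧_; T)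
open import Data.List using (List; []; _∷_; [_]; map; concatMap; concat; zipWith; zip; replicate; upTo; length; filter)
open import Data.Bool.ListAction using (and)
open import Data.Nat.ListAction using (sum)
open import Data.Product using (_,_; uncurry)
open import Relation.Nullary.Decidable using (T?)

-- All words of length len over the alphabet {0, …, r-1}.
-- (The paper's letters 1..r are encoded as 0..r-1.)
allWords : ℕ → ℕ → List (List ℕ)
allWords r zero = [ [] ]
allWords r (suc len) = concatMap (λ a → map (a ∷_) (allWords r len)) (upTo r)

baseWord : List ℕ → List ℕ
baseWord s = concat (zipWith replicate s (upTo (length s)))

occ : ℕ → List ℕ → ℕ
occ x w = length (filter (λ y → T? (x ≡ᵇ y)) w)

-- a is a rearrangement of 1^{s_1}⋯r^{s_r}: letter i occurs exactly s_i times
-- (a is taken among words of length s_1+⋯+s_r over the alphabet of size r).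
hasCounts : List ℕ → List ℕ → Bool
hasCounts s a = and (map (uncurry (λ i si → occ i a ≡ᵇ si)) (zip (upTo (length s)) s))

noFixed : List ℕ → List ℕ → Bool
noFixed a w = and (zipWith (λ x y → not (x ≡ᵇ y)) a w)

good : List ℕ → List ℕ → Bool
good s a = hasCounts s a ∧ noFixed a (baseWord s)

-- P'(s_1,…,s_r): number of anagrams without fixed letters of 1^{s_1}⋯r^{s_r}.
P′ : List ℕ → ℕ
P′ s = length (filter (λ a → T? (good s a)) (allWords (length s) (sum s)))

-- Anagrams are counted by D r w c: the number of words over {0, …, r-1} with letter
-- multiplicities c that differ from w at every position, computed by choosing the first
-- letter.  D is invariant under
-- rearranging w (D-perm) and under renaming the letters by a permutation of the alphabet
-- (D-relabel).  Write the base word as w ++ B, where B = m^k (m+1)^k ⋯ (m+n-1)^k is the block of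
-- the n letters of multiplicity k and w only uses letters below m.  Rotating the block letters
-- cyclically permutes B up to rearrangement, so when the first position of w receives a block
-- letter, all n block letters yield the same count; these n terms add up to a multiple of n.
-- Dropping them and inducting on w gives  D(w ++ B) ≡ D(w) · D(B)  (mod n)  (Block.factor-%),
-- and the two factors are P′(t) and P′(k, …, k).

module Submission where

open import Defs
open import Data.Nat using (ℕ; _*_; _%_; _≤_; NonZero)
open import Data.List using (replicate; _++_)
open import Data.Vec using (Vec; toList)
open import Relation.Binary.PropositionalEquality using (_≡_)

open import Data.Nat
  using (zero; suc; pred; _+_; _∸_; _<_; _≡ᵇ_; _<ᵇ_; z≤n; s≤s; z<s; s<s; >-nonZero; ≢-nonZero⁻¹)
open import Data.Nat.Properties
open import Data.Nat.DivMod using (%-distribˡ-+; [m+kn]%n≡m%n)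
open import Data.Nat.ListAction using (sum)
open import Algebra.Properties.CommutativeSemigroup +-commutativeSemigroup
  using () renaming (interchange to +-interchange)
open import Data.Bool using (Bool; true; false; not; _∧_; T; if_then_else_)
open import Data.Bool.Properties using (T-∧; ∧-identityʳ; ∧-comm)
open import Data.Bool.ListAction using (and)
open import Data.Unit using (tt)
open import Data.Empty using (⊥-elim)
open import Data.Product using (_×_; _,_; proj₁; proj₂; uncurry)
open import Data.List using (List; []; _∷_; map; applyUpTo; length; concat; concatMap; filter; zip; zipWith)
open import Data.List.Properties
  using (length-++; length-replicate; map-++; map-replicate; ++-assoc; ++-identityʳ; map-id-local)
open import Data.List.Relation.Unary.All as All using (All; []; _∷_)
import Data.List.Relation.Unary.All.Properties as Allₚ
open import Data.List.Relation.Binary.Permutation.Propositional using (_↭_; ↭-sym)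
  renaming (refl to ↭-refl; prep to ↭-prep; swap to ↭-swap; trans to ↭-trans)
open import Data.List.Relation.Binary.Permutation.Propositional.Properties
  using () renaming (++-comm to ↭-++-comm; ++⁺ˡ to ↭-++⁺ˡ)
open import Function using (_∘_)
open import Function.Bundles using (Equivalence)
open import Relation.Binary.Definitions using (tri<; tri≈; tri>)
open import Relation.Binary.PropositionalEquality
  using (_≢_; refl; sym; trans; cong; cong₂; subst; module ≡-Reasoning)
open import Relation.Nullary using (yes; no)
open import Relation.Nullary.Decidable using (T?)

∑ : ℕ → (ℕ → ℕ) → ℕ
∑ zero    f = 0
∑ (suc r) f = f 0 + ∑ r (λ i → f (suc i))

∑-cong : ∀ r {f g : ℕ → ℕ} → (∀ i → i < r → f i ≡ g i) → ∑ r f ≡ ∑ r g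
∑-cong zero    f≗g = refl
∑-cong (suc r) f≗g = cong₂ _+_ (f≗g 0 z<s) (∑-cong r (λ i i<r → f≗g (suc i) (s<s i<r)))

∑-zero : ∀ r {f : ℕ → ℕ} → (∀ i → i < r → f i ≡ 0) → ∑ r f ≡ 0
∑-zero zero    f≡0 = refl
∑-zero (suc r) f≡0 = cong₂ _+_ (f≡0 0 z<s) (∑-zero r (λ i i<r → f≡0 (suc i) (s<s i<r)))

∑≡0⇒ : ∀ r (f : ℕ → ℕ) → ∑ r f ≡ 0 → ∀ i → i < r → f i ≡ 0
∑≡0⇒ (suc r) f sum≡0 zero    _         = m+n≡0⇒m≡0 (f 0) sum≡0
∑≡0⇒ (suc r) f sum≡0 (suc i) (s<s i<r) = ∑≡0⇒ r (λ i → f (suc i)) (m+n≡0⇒n≡0 (f 0) sum≡0) i i<r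

∑-const : ∀ r q → ∑ r (λ _ → q) ≡ r * q
∑-const zero    q = refl
∑-const (suc r) q = cong (q +_) (∑-const r q)

∑-split : ∀ m n (f : ℕ → ℕ) → ∑ (m + n) f ≡ ∑ m f + ∑ n (λ j → f (m + j))
∑-split zero    n f = refl
∑-split (suc m) n f = trans (cong (f 0 +_) (∑-split m n (λ i → f (suc i)))) (sym (+-assoc (f 0) _ _))

∑-truncate : ∀ m n (f : ℕ → ℕ) → (∀ j → j < n → f (m + j) ≡ 0) → ∑ (m + n) f ≡ ∑ m f
∑-truncate m n f tail≡0 = trans (∑-split m n f) (trans (cong (∑ m f +_) (∑-zero n tail≡0)) (+-identityʳ (∑ m f)))

∑-last : ∀ n (f : ℕ → ℕ) → ∑ (suc n) f ≡ ∑ n f + f n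
∑-last zero    f = +-comm (f 0) 0
∑-last (suc n) f = trans (cong (f 0 +_) (∑-last n (λ i → f (suc i)))) (sym (+-assoc (f 0) _ _))

∑-+ : ∀ r (f g : ℕ → ℕ) → ∑ r (λ i → f i + g i) ≡ ∑ r f + ∑ r g
∑-+ zero    f g = refl
∑-+ (suc r) f g = begin
    (f 0 + g 0) + ∑ r (λ i → f (suc i) + g (suc i))
  ≡⟨ cong ((f 0 + g 0) +_) (∑-+ r (λ i → f (suc i)) (λ i → g (suc i))) ⟩
    (f 0 + g 0) + (∑ r (λ i → f (suc i)) + ∑ r (λ i → g (suc i)))
  ≡⟨ +-interchange (f 0) (g 0) _ _ ⟩
    (f 0 + ∑ r (λ i → f (suc i))) + (g 0 + ∑ r (λ i → g (suc i)))
  ∎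
  where open ≡-Reasoning

∑-*ʳ : ∀ r (f : ℕ → ℕ) q → ∑ r f * q ≡ ∑ r (λ i → f i * q)
∑-*ʳ zero    f q = refl
∑-*ʳ (suc r) f q = trans (*-distribʳ-+ q (f 0) _) (cong (f 0 * q +_) (∑-*ʳ r _ q))

∑-swap : ∀ r (F : ℕ → ℕ → ℕ) → ∑ r (λ a → ∑ r (λ b → F a b)) ≡ ∑ r (λ b → ∑ r (λ a → F a b))
∑-swap zero    F = refl
∑-swap (suc r) F = begin
    (F 0 0 + row) + ∑ r (λ a → F (suc a) 0 + ∑ r (λ b → F (suc a) (suc b)))
  ≡⟨ cong ((F 0 0 + row) +_) (∑-+ r _ _) ⟩
    (F 0 0 + row) + (col + ∑ r (λ a → ∑ r (λ b → F (suc a) (suc b))))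
  ≡⟨ cong (λ z → (F 0 0 + row) + (col + z)) (∑-swap r (λ a b → F (suc a) (suc b))) ⟩
    (F 0 0 + row) + (col + ∑ r (λ b → ∑ r (λ a → F (suc a) (suc b))))
  ≡⟨ +-interchange (F 0 0) row col _ ⟩
    (F 0 0 + col) + (row + ∑ r (λ b → ∑ r (λ a → F (suc a) (suc b))))
  ≡⟨ cong ((F 0 0 + col) +_) (sym (∑-+ r _ _)) ⟩
    (F 0 0 + col) + ∑ r (λ b → F 0 (suc b) + ∑ r (λ a → F (suc a) (suc b)))
  ∎
  where
  open ≡-Reasoning
  row = ∑ r (λ b → F 0 (suc b))
  col = ∑ r (λ a → F (suc a) 0)

∑-cong-% : ∀ n .{{_ : NonZero n}} r {f g : ℕ → ℕ} → (∀ i → i < r → f i % n ≡ g i % n) → ∑ r f % n ≡ ∑ r g % n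
∑-cong-% n zero    f≡g = refl
∑-cong-% n (suc r) {f} {g} f≡g = begin
    (f 0 + ∑ r (λ i → f (suc i))) % n
  ≡⟨ %-distribˡ-+ (f 0) _ n ⟩
    (f 0 % n + ∑ r (λ i → f (suc i)) % n) % n
  ≡⟨ cong₂ (λ a b → (a + b) % n) (f≡g 0 z<s) (∑-cong-% n r (λ i i<r → f≡g (suc i) (s<s i<r))) ⟩
    (g 0 % n + ∑ r (λ i → g (suc i)) % n) % n
  ≡⟨ sym (%-distribˡ-+ (g 0) _ n) ⟩
    (g 0 + ∑ r (λ i → g (suc i))) % n
  ∎
  where open ≡-Reasoning

T-injective : ∀ {a b : Bool} → (T a → T b) → (T b → T a) → a ≡ b
T-injective {false} {false} _ _ = refl
T-injective {false} {true}  _ g = ⊥-elim (g tt)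
T-injective {true}  {false} f _ = ⊥-elim (f tt)
T-injective {true}  {true}  _ _ = refl

≡ᵇ-true : ∀ {a b} → a ≡ b → (a ≡ᵇ b) ≡ true
≡ᵇ-true {a} refl = T-injective (λ _ → tt) (λ _ → ≡⇒≡ᵇ a a refl)

≡ᵇ-false : ∀ {a b} → a ≢ b → (a ≡ᵇ b) ≡ false
≡ᵇ-false {a} {b} a≢b = T-injective (λ t → a≢b (≡ᵇ⇒≡ a b t)) λ ()

<ᵇ-true : ∀ {i m} → i < m → (i <ᵇ m) ≡ true
<ᵇ-true i<m = T-injective (λ _ → tt) (λ _ → <⇒<ᵇ i<m)

<ᵇ-false : ∀ {i m} → m ≤ i → (i <ᵇ m) ≡ false
<ᵇ-false {i} {m} m≤i = T-injective (λ t → <⇒≱ (<ᵇ⇒< i m t) m≤i) λ ()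

T-∧⁻ : ∀ {a b} → T (a ∧ b) → T a × T b
T-∧⁻ = Equivalence.to T-∧

T-∧⁺ : ∀ {a b} → T a → T b → T (a ∧ b)
T-∧⁺ ta tb = Equivalence.from T-∧ (ta , tb)

T-and⁻ : ∀ bs → T (and bs) → All T bs
T-and⁻ []            _ = []
T-and⁻ (true  ∷ bs)  t = tt ∷ T-and⁻ bs t

T-and⁺ : ∀ {bs} → All T bs → T (and bs)
T-and⁺ {[]}         []       = tt
T-and⁺ {true ∷ bs}  (_ ∷ ts) = T-and⁺ ts

T-allBelow⁻ : ∀ r (p : ℕ → Bool) → T (and (applyUpTo p r)) → ∀ i → i < r → T (p i)
T-allBelow⁻ r p t i i<r = Allₚ.applyUpTo⁻ p r (T-and⁻ _ t) i<r

T-allBelow⁺ : ∀ r (p : ℕ → Bool) → (∀ i → i < r → T (p i)) → T (and (applyUpTo p r))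
T-allBelow⁺ r p h = T-and⁺ (Allₚ.applyUpTo⁺₁ p r (λ {i} → h i))

_⊖_ : (ℕ → ℕ) → ℕ → (ℕ → ℕ)
(c ⊖ a) i = if i ≡ᵇ a then pred (c i) else c i

allowed : ℕ → (ℕ → ℕ) → ℕ → Bool
allowed x c a = not (a ≡ᵇ x) ∧ (0 <ᵇ c a)

when : Bool → ℕ → ℕ
when b n = if b then n else 0

-- D r w c is the number of words over the alphabet {0, …, r-1}, as long as w, in which each
-- letter i < r occurs exactly c i times and which differ from w at every position.
D : ℕ → List ℕ → (ℕ → ℕ) → ℕ
D r []      c = when (∑ r c ≡ᵇ 0) 1
D r (x ∷ w) c = ∑ r (λ a → when (allowed x c a) (D r w (c ⊖ a)))

count : (List ℕ → Bool) → List (List ℕ) → ℕ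
count p l = length (filter (λ u → T? (p u)) l)

count-++ : ∀ p l₁ l₂ → count p (l₁ ++ l₂) ≡ count p l₁ + count p l₂
count-++ p []       l₂ = refl
count-++ p (u ∷ l₁) l₂ with p u
... | true  = cong suc (count-++ p l₁ l₂)
... | false = count-++ p l₁ l₂

count-concatMap : ∀ p (h : ℕ → List (List ℕ)) r (f : ℕ → ℕ) →
  count p (concatMap h (applyUpTo f r)) ≡ ∑ r (λ i → count p (h (f i)))
count-concatMap p h zero    f = refl
count-concatMap p h (suc r) f =
  trans (count-++ p (h (f 0)) _) (cong (count p (h (f 0)) +_) (count-concatMap p h r (λ i → f (suc i))))

count-prefix : ∀ p a l → count p (map (a ∷_) l) ≡ count (λ u → p (a ∷ u)) l
count-prefix p a []      = refl
count-prefix p a (u ∷ l) with p (a ∷ u)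
... | true  = cong suc (count-prefix p a l)
... | false = count-prefix p a l

count-cong : ∀ {p q} l → (∀ u → p u ≡ q u) → count p l ≡ count q l
count-cong []          p≗q = refl
count-cong {p} {q} (u ∷ l) p≗q rewrite p≗q u with q u
... | true  = cong suc (count-cong l p≗q)
... | false = count-cong l p≗q

count-when : ∀ b q l → count (λ u → b ∧ q u) l ≡ when b (count q l)
count-when true  q l = refl
count-when false q []      = refl
count-when false q (u ∷ l) = count-when false q l

hasContent : ℕ → (ℕ → ℕ) → List ℕ → Bool
hasContent r c u = and (applyUpTo (λ i → occ i u ≡ᵇ c i) r)

hasContent-[] : ∀ r c → hasContent r c [] ≡ (∑ r c ≡ᵇ 0)
hasContent-[] zero    c = refl
hasContent-[] (suc r) c with c 0
... | zero  = hasContent-[] r (λ i → c (suc i))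
... | suc _ = refl

occ-∷ : ∀ i a u → occ i (a ∷ u) ≡ (if i ≡ᵇ a then suc (occ i u) else occ i u)
occ-∷ i a u with i ≡ᵇ a
... | true  = refl
... | false = refl

hasContent-∷ : ∀ r c a u → a < r → hasContent r c (a ∷ u) ≡ (0 <ᵇ c a) ∧ hasContent r (c ⊖ a) u
hasContent-∷ r c a u a<r = T-injective forward backward
  where
  forward : T (hasContent r c (a ∷ u)) → T ((0 <ᵇ c a) ∧ hasContent r (c ⊖ a) u)
  forward t = T-∧⁺ (<⇒<ᵇ 0<ca) (T-allBelow⁺ r _ (λ i i<r → ≡⇒≡ᵇ _ _ (occ-u i i<r)))
    where
    occ-a∷u : ∀ i → i < r → occ i (a ∷ u) ≡ c i
    occ-a∷u i i<r = ≡ᵇ⇒≡ _ _ (T-allBelow⁻ r (λ i → occ i (a ∷ u) ≡ᵇ c i) t i i<r)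
    0<ca : 0 < c a
    0<ca rewrite sym (occ-a∷u a a<r) | occ-∷ a a u | ≡ᵇ-true {a} refl = z<s
    occ-u : ∀ i → i < r → occ i u ≡ (c ⊖ a) i
    occ-u i i<r with occ-a∷u i i<r
    ... | e with i ≡ᵇ a
    ... | true  = cong pred e
    ... | false = e
  backward : T ((0 <ᵇ c a) ∧ hasContent r (c ⊖ a) u) → T (hasContent r c (a ∷ u))
  backward t = T-allBelow⁺ r _ (λ i i<r → ≡⇒≡ᵇ _ _ (occ-a∷u i i<r))
    where
    0<ca : 0 < c a
    0<ca = <ᵇ⇒< 0 (c a) (proj₁ (T-∧⁻ t))
    occ-u : ∀ i → i < r → occ i u ≡ (c ⊖ a) i
    occ-u i i<r = ≡ᵇ⇒≡ _ _ (T-allBelow⁻ r (λ i → occ i u ≡ᵇ (c ⊖ a) i) (proj₂ (T-∧⁻ {0 <ᵇ c a} t)) i i<r)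
    occ-a∷u : ∀ i → i < r → occ i (a ∷ u) ≡ c i
    occ-a∷u i i<r with occ-u i i<r | ≡ᵇ⇒≡ i a
    ... | e | i≡a with i ≡ᵇ a
    ... | true rewrite i≡a tt = trans (cong suc e) (suc-pred (c a) {{>-nonZero 0<ca}})
    ... | false = e

count≡D : ∀ r w c → count (λ a → hasContent r c a ∧ noFixed a w) (allWords r (length w)) ≡ D r w c
count≡D r []      c rewrite ∧-identityʳ (hasContent r c []) | hasContent-[] r c with ∑ r c ≡ᵇ 0
... | true  = refl
... | false = refl
count≡D r (x ∷ w) c =
  trans (count-concatMap _ (λ a → map (a ∷_) (allWords r (length w))) r (λ i → i)) (∑-cong r first-letter)
  where
  regroup : ∀ p h n f → (p ∧ h) ∧ (n ∧ f) ≡ (n ∧ p) ∧ (h ∧ f)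
  regroup true  true  true  f = refl
  regroup true  true  false f = refl
  regroup true  false true  f = refl
  regroup true  false false f = refl
  regroup false h     true  f = refl
  regroup false h     false f = refl
  first-letter : ∀ a → a < r →
    count (λ u → hasContent r c u ∧ noFixed u (x ∷ w)) (map (a ∷_) (allWords r (length w)))
      ≡ when (allowed x c a) (D r w (c ⊖ a))
  first-letter a a<r = begin
      count (λ u → hasContent r c u ∧ noFixed u (x ∷ w)) (map (a ∷_) words)
    ≡⟨ count-prefix _ a words ⟩
      count (λ u → hasContent r c (a ∷ u) ∧ (not (a ≡ᵇ x) ∧ noFixed u w)) words
    ≡⟨ count-cong words (λ u → trans (cong (_∧ (not (a ≡ᵇ x) ∧ noFixed u w)) (hasContent-∷ r c a u a<r))
                                      (regroup (0 <ᵇ c a) _ (not (a ≡ᵇ x)) _)) ⟩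
      count (λ u → allowed x c a ∧ (hasContent r (c ⊖ a) u ∧ noFixed u w)) words
    ≡⟨ count-when (allowed x c a) _ words ⟩
      when (allowed x c a) (count (λ u → hasContent r (c ⊖ a) u ∧ noFixed u w) words)
    ≡⟨ cong (when (allowed x c a)) (count≡D r w (c ⊖ a)) ⟩
      when (allowed x c a) (D r w (c ⊖ a))
    ∎
    where
    open ≡-Reasoning
    words = allWords r (length w)

base : ℕ → List ℕ → List ℕ
base o []      = []
base o (x ∷ s) = replicate x o ++ base (suc o) s

content : List ℕ → ℕ → ℕ
content []      i       = 0
content (x ∷ s) zero    = x
content (x ∷ s) (suc i) = content s i

length-base : ∀ o s → length (base o s) ≡ sum s
length-base o []      = refl
length-base o (x ∷ s) = trans (length-++ (replicate x o)) (cong₂ _+_ (length-replicate x) (length-base (suc o) s))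

sum-replicate : ∀ n k → sum (replicate n k) ≡ n * k
sum-replicate zero    k = refl
sum-replicate (suc n) k = cong (k +_) (sum-replicate n k)

baseWord≡base : ∀ s → baseWord s ≡ base 0 s
baseWord≡base s = go s (λ i → i) 0 (λ i → refl)
  where
  go : ∀ s f o → (∀ i → f i ≡ o + i) → concat (zipWith replicate s (applyUpTo f (length s))) ≡ base o s
  go []      f o f≗o+ = refl
  go (x ∷ s) f o f≗o+ = cong₂ _++_ (cong (replicate x) (trans (f≗o+ 0) (+-identityʳ o)))
    (go s (λ i → f (suc i)) (suc o) (λ i → trans (f≗o+ (suc i)) (+-suc o i)))

hasCounts≡hasContent : ∀ s a → hasCounts s a ≡ hasContent (length s) (content s) a
hasCounts≡hasContent s a = cong and (go s (λ i → i))
  where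
  go : ∀ s f → map (uncurry (λ i si → occ i a ≡ᵇ si)) (zip (applyUpTo f (length s)) s)
             ≡ applyUpTo (λ i → occ (f i) a ≡ᵇ content s i) (length s)
  go []      f = refl
  go (x ∷ s) f = cong (_ ∷_) (go s (λ i → f (suc i)))

P′≡D : ∀ s → P′ s ≡ D (length s) (base 0 s) (content s)
P′≡D s = begin
    P′ s
  ≡⟨ cong (λ len → count (good s) (allWords (length s) len)) (sym (length-base 0 s)) ⟩
    count (good s) words
  ≡⟨ count-cong words (λ a → cong₂ _∧_ (hasCounts≡hasContent s a) (cong (noFixed a) (baseWord≡base s))) ⟩
    count (λ a → hasContent (length s) (content s) a ∧ noFixed a (base 0 s)) words
  ≡⟨ count≡D (length s) (base 0 s) (content s) ⟩
    D (length s) (base 0 s) (content s)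
  ∎
  where
  open ≡-Reasoning
  words = allWords (length s) (length (base 0 s))

⊖-cong : ∀ r {c d : ℕ → ℕ} a → (∀ i → i < r → c i ≡ d i) → ∀ i → i < r → (c ⊖ a) i ≡ (d ⊖ a) i
⊖-cong r a c≗d i i<r rewrite c≗d i i<r = refl

D-cong : ∀ r w {c d} → (∀ i → i < r → c i ≡ d i) → D r w c ≡ D r w d
D-cong r []      c≗d = cong (λ s → when (s ≡ᵇ 0) 1) (∑-cong r c≗d)
D-cong r (x ∷ w) {c} {d} c≗d = ∑-cong r term
  where
  term : ∀ a → a < r → when (allowed x c a) (D r w (c ⊖ a)) ≡ when (allowed x d a) (D r w (d ⊖ a))
  term a a<r rewrite c≗d a a<r = cong (when (allowed x d a)) (D-cong r w (⊖-cong r a c≗d))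

allowed⇒available : ∀ x c a → T (allowed x c a) → 0 < c a
allowed⇒available x c a t = <ᵇ⇒< 0 (c a) (proj₂ (T-∧⁻ {not (a ≡ᵇ x)} t))

unavailable : ∀ {n} x (c : ℕ → ℕ) a → c a ≡ 0 → when (allowed x c a) n ≡ 0
unavailable {n} x c a ca≡0 rewrite ca≡0 with not (a ≡ᵇ x)
... | true  = refl
... | false = refl

⊖-absent : ∀ (c : ℕ → ℕ) a i → c i ≡ 0 → (c ⊖ a) i ≡ 0
⊖-absent c a i ci≡0 with i ≡ᵇ a
... | true  rewrite ci≡0 = refl
... | false = ci≡0

∑-⊖ : ∀ r (c : ℕ → ℕ) a → a < r → 0 < c a → ∑ r c ≡ suc (∑ r (c ⊖ a))
∑-⊖ (suc r) c zero    _         0<ca with c 0 | 0<ca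
... | suc x | _ = cong (suc x +_) (∑-cong r (λ _ _ → refl))
∑-⊖ (suc r) c (suc a) (s<s a<r) 0<ca =
  trans (cong (c 0 +_) (∑-⊖ r (λ i → c (suc i)) a a<r 0<ca))
        (trans (+-suc (c 0) _) (cong (λ z → suc (c 0 + z)) (∑-cong r (λ _ _ → refl))))

D-vanishes : ∀ r w c → ∑ r c ≢ length w → D r w c ≡ 0
D-vanishes r []      c ∑≢0 rewrite ≡ᵇ-false ∑≢0 = refl
D-vanishes r (x ∷ w) c ∑≢len = ∑-zero r term
  where
  term : ∀ a → a < r → when (allowed x c a) (D r w (c ⊖ a)) ≡ 0
  term a a<r with allowed x c a in eq
  ... | false = refl
  ... | true  = D-vanishes r w (c ⊖ a) λ ∑≡len →
    ∑≢len (trans (∑-⊖ r c a a<r (allowed⇒available x c a (subst T (sym eq) tt))) (cong suc ∑≡len))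

D-extend : ∀ m n w c → (∀ j → j < n → c (m + j) ≡ 0) → D (m + n) w c ≡ D m w c
D-extend m n []      c absent rewrite ∑-truncate m n c absent = refl
D-extend m n (x ∷ w) c absent = begin
    ∑ (m + n) term
  ≡⟨ ∑-truncate m n term (λ j j<n → unavailable x c (m + j) (absent j j<n)) ⟩
    ∑ m term
  ≡⟨ ∑-cong m (λ a _ → cong (when (allowed x c a))
                        (D-extend m n w (c ⊖ a) (λ j j<n → ⊖-absent c a (m + j) (absent j j<n)))) ⟩
    D m (x ∷ w) c
  ∎
  where
  open ≡-Reasoning
  term = λ a → when (allowed x c a) (D (m + n) w (c ⊖ a))

+-≡ᵇ : ∀ m a b → (m + a ≡ᵇ m + b) ≡ (a ≡ᵇ b)
+-≡ᵇ zero    a b = refl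
+-≡ᵇ (suc m) a b = +-≡ᵇ m a b

D-shift : ∀ m n w c → (∀ a → a < m → c a ≡ 0) → D (m + n) (map (m +_) w) c ≡ D n w (λ j → c (m + j))
D-shift m n []      c absent rewrite ∑-split m n c | ∑-zero m absent = refl
D-shift m n (x ∷ w) c absent = begin
    ∑ (m + n) term
  ≡⟨ ∑-split m n term ⟩
    ∑ m term + ∑ n (λ j → term (m + j))
  ≡⟨ cong (_+ ∑ n (λ j → term (m + j))) (∑-zero m (λ a a<m → unavailable (m + x) c a (absent a a<m))) ⟩
    ∑ n (λ j → term (m + j))
  ≡⟨ ∑-cong n (λ j _ → shifted j) ⟩
    D n (x ∷ w) (λ j → c (m + j))
  ∎
  where
  open ≡-Reasoning
  term = λ a → when (allowed (m + x) c a) (D (m + n) (map (m +_) w) (c ⊖ a))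
  shifted : ∀ j → term (m + j) ≡ when (allowed x (λ j → c (m + j)) j) (D n w ((λ j → c (m + j)) ⊖ j))
  shifted j rewrite +-≡ᵇ m j x = cong (when (allowed x (λ j → c (m + j)) j))
    (trans (D-shift m n w (c ⊖ (m + j)) (λ a a<m → ⊖-absent c (m + j) a (absent a a<m)))
           (D-cong n w (λ i _ → cong (λ b → if b then pred (c (m + i)) else c (m + i)) (+-≡ᵇ m i j))))

when-∑ : ∀ r b (f : ℕ → ℕ) → when b (∑ r f) ≡ ∑ r (λ a → when b (f a))
when-∑ r true  f = refl
when-∑ r false f = sym (∑-zero r (λ _ _ → refl))

when-when : ∀ p q n → when p (when q n) ≡ when (p ∧ q) n
when-when true  q n = refl
when-when false q n = refl

when-* : ∀ b n q → when b n * q ≡ when b (n * q)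
when-* true  n q = refl
when-* false n q = refl

⊖-comm : ∀ (c : ℕ → ℕ) a b i → ((c ⊖ a) ⊖ b) i ≡ ((c ⊖ b) ⊖ a) i
⊖-comm c a b i with i ≡ᵇ a | i ≡ᵇ b
... | true  | true  = refl
... | true  | false = refl
... | false | true  = refl
... | false | false = refl

allowed-comm : ∀ x y c a b → allowed x c a ∧ allowed y (c ⊖ a) b ≡ allowed y c b ∧ allowed x (c ⊖ b) a
allowed-comm x y c a b with a ≟ b
... | yes refl rewrite ≡ᵇ-true {a} refl = exchange (not (a ≡ᵇ x)) (not (a ≡ᵇ y)) _ _
  where
  exchange : ∀ p q u v → (p ∧ u) ∧ (q ∧ v) ≡ (q ∧ u) ∧ (p ∧ v)
  exchange true  true  u v = refl
  exchange true  false u v = ∧-comm u false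
  exchange false true  u v = sym (∧-comm u false)
  exchange false false u v = refl
... | no a≢b rewrite ≡ᵇ-false (a≢b ∘ sym) | ≡ᵇ-false a≢b = ∧-comm (allowed x c a) (allowed y c b)

D-swap : ∀ r x y w w′ → (∀ c → D r w c ≡ D r w′ c) → ∀ c → D r (x ∷ y ∷ w) c ≡ D r (y ∷ x ∷ w′) c
D-swap r x y w w′ w≈w′ c = begin
    ∑ r (λ a → when (allowed x c a) (∑ r (λ b → when (allowed y (c ⊖ a) b) (D r w ((c ⊖ a) ⊖ b)))))
  ≡⟨ ∑-cong r (λ a _ → when-∑ r (allowed x c a) _) ⟩
    ∑ r (λ a → ∑ r (λ b → when (allowed x c a) (when (allowed y (c ⊖ a) b) (D r w ((c ⊖ a) ⊖ b)))))
  ≡⟨ ∑-cong r (λ a _ → ∑-cong r (λ b _ → two-letters a b)) ⟩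
    ∑ r (λ a → ∑ r (λ b → when (allowed y c b) (when (allowed x (c ⊖ b) a) (D r w′ ((c ⊖ b) ⊖ a)))))
  ≡⟨ ∑-swap r _ ⟩
    ∑ r (λ b → ∑ r (λ a → when (allowed y c b) (when (allowed x (c ⊖ b) a) (D r w′ ((c ⊖ b) ⊖ a)))))
  ≡⟨ ∑-cong r (λ b _ → sym (when-∑ r (allowed y c b) _)) ⟩
    ∑ r (λ b → when (allowed y c b) (∑ r (λ a → when (allowed x (c ⊖ b) a) (D r w′ ((c ⊖ b) ⊖ a)))))
  ∎
  where
  open ≡-Reasoning
  two-letters : ∀ a b → when (allowed x c a) (when (allowed y (c ⊖ a) b) (D r w ((c ⊖ a) ⊖ b)))
                      ≡ when (allowed y c b) (when (allowed x (c ⊖ b) a) (D r w′ ((c ⊖ b) ⊖ a)))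
  two-letters a b
    rewrite when-when (allowed x c a) (allowed y (c ⊖ a) b) (D r w ((c ⊖ a) ⊖ b))
          | when-when (allowed y c b) (allowed x (c ⊖ b) a) (D r w′ ((c ⊖ b) ⊖ a))
          | allowed-comm x y c a b
          | w≈w′ ((c ⊖ a) ⊖ b)
    = cong (when (allowed y c b ∧ allowed x (c ⊖ b) a)) (D-cong r w′ (λ i _ → ⊖-comm c a b i))

D-perm : ∀ r {w w′} → w ↭ w′ → ∀ c → D r w c ≡ D r w′ c
D-perm r ↭-refl                             c = refl
D-perm r (↭-prep x w↭w′)                    c = ∑-cong r (λ a _ → cong (when (allowed x c a)) (D-perm r w↭w′ (c ⊖ a)))
D-perm r (↭-swap {xs = w} {ys = w′} x y w↭w′) c = D-swap r x y w w′ (D-perm r w↭w′) c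
D-perm r (↭-trans p q)                      c = trans (D-perm r p c) (D-perm r q c)

≡ᵇ-injective : ∀ (π : ℕ → ℕ) → (∀ a b → π a ≡ π b → a ≡ b) → ∀ a b → (π a ≡ᵇ π b) ≡ (a ≡ᵇ b)
≡ᵇ-injective π π-inj a b with a ≟ b
... | yes refl = trans (≡ᵇ-true {π a} refl) (sym (≡ᵇ-true {a} refl))
... | no a≢b   = trans (≡ᵇ-false (a≢b ∘ π-inj a b)) (sym (≡ᵇ-false a≢b))

⊖-rename : ∀ (π : ℕ → ℕ) → (∀ a b → π a ≡ π b → a ≡ b) → ∀ c a i → ((c ⊖ π a) ∘ π) i ≡ ((c ∘ π) ⊖ a) i
⊖-rename π π-inj c a i = cong (λ b → if b then pred (c (π i)) else c (π i)) (≡ᵇ-injective π π-inj i a)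

-- Renaming the letters by a permutation π of {0, …, r-1} (an injection leaving sums over
-- the alphabet invariant), simultaneously in the word and in the content, does not change D.
D-relabel : ∀ r (π : ℕ → ℕ) → (∀ a b → π a ≡ π b → a ≡ b) → (∀ f → ∑ r (f ∘ π) ≡ ∑ r f) →
  ∀ w c → D r (map π w) c ≡ D r w (c ∘ π)
D-relabel r π π-inj ∑-π []      c rewrite ∑-π c = refl
D-relabel r π π-inj ∑-π (x ∷ w) c = begin
    ∑ r term
  ≡⟨ sym (∑-π term) ⟩
    ∑ r (term ∘ π)
  ≡⟨ ∑-cong r (λ a _ → renamed a) ⟩
    D r (x ∷ w) (c ∘ π)
  ∎
  where
  open ≡-Reasoning
  term = λ a → when (allowed (π x) c a) (D r (map π w) (c ⊖ a))
  renamed : ∀ a → term (π a) ≡ when (allowed x (c ∘ π) a) (D r w ((c ∘ π) ⊖ a))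
  renamed a rewrite ≡ᵇ-injective π π-inj a x = cong (when (allowed x (c ∘ π) a))
    (trans (D-relabel r π π-inj ∑-π w (c ⊖ π a))
           (D-cong r w (λ i _ → ⊖-rename π π-inj c a i)))

base-++ : ∀ o s u → base o (s ++ u) ≡ base o s ++ base (o + length s) u
base-++ o []      u = cong (λ o′ → base o′ u) (sym (+-identityʳ o))
base-++ o (x ∷ s) u = trans (cong (replicate x o ++_) (trans (base-++ (suc o) s u)
                                     (cong (λ o′ → base (suc o) s ++ base o′ u) (sym (+-suc o (length s))))))
                            (sym (++-assoc (replicate x o) _ _))

base-bounded : ∀ o s → All (_< o + length s) (base o s)
base-bounded o []      = []
base-bounded o (x ∷ s) = Allₚ.++⁺ (Allₚ.replicate⁺ x (m<m+n o (s≤s z≤n)))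
  (All.map (λ {y} y< → subst (y <_) (sym (+-suc o (length s))) y<) (base-bounded (suc o) s))

base-shift : ∀ m o s → map (m +_) (base o s) ≡ base (m + o) s
base-shift m o []      = refl
base-shift m o (x ∷ s) = trans (map-++ (m +_) (replicate x o) _)
  (cong₂ _++_ (map-replicate (m +_) x o) (trans (base-shift m (suc o) s) (cong (λ o′ → base o′ s) (+-suc m o))))

base-replicate-∷ʳ : ∀ o n k → base o (replicate (suc n) k) ≡ base o (replicate n k) ++ replicate k (o + n)
base-replicate-∷ʳ o zero    k = trans (++-identityʳ (replicate k o)) (cong (replicate k) (sym (+-identityʳ o)))
base-replicate-∷ʳ o (suc n) k = trans (cong (replicate k o ++_) (base-replicate-∷ʳ (suc o) n k))
  (trans (sym (++-assoc (replicate k o) _ _))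
         (cong (λ z → base o (replicate (suc n) k) ++ replicate k z) (sym (+-suc o n))))

base-replicate-suc : ∀ (f : ℕ → ℕ) o n k → (∀ j → j < n → f (o + j) ≡ suc (o + j)) →
  map f (base o (replicate n k)) ≡ base (suc o) (replicate n k)
base-replicate-suc f o zero    k f-suc = refl
base-replicate-suc f o (suc n) k f-suc = trans (map-++ f (replicate k o) _)
  (cong₂ _++_ (trans (map-replicate f k o) (cong (replicate k) first))
              (base-replicate-suc f (suc o) n k
                 (λ j j<n → trans (cong f (sym (+-suc o j))) (trans (f-suc (suc j) (s<s j<n)) (cong suc (+-suc o j))))))
  where
  first : f o ≡ suc o
  first = trans (cong f (sym (+-identityʳ o))) (trans (f-suc 0 z<s) (cong suc (+-identityʳ o)))

data Region (m n′ : ℕ) : ℕ → Set where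
  below  : ∀ {i} → i < m → Region m n′ i
  inside : ∀ j → j < n′ → Region m n′ (m + j)
  top    : Region m n′ (m + n′)
  above  : ∀ {i} → m + n′ < i → Region m n′ i

region : ∀ m n′ i → Region m n′ i
region m n′ i with i <? m
... | yes i<m = below i<m
... | no  i≮m = subst (Region m n′) (m+[n∸m]≡n (≮⇒≥ i≮m)) (offset (i ∸ m))
  where
  offset : ∀ j → Region m n′ (m + j)
  offset j with <-cmp j n′
  ... | tri< j<n′ _ _ = inside j j<n′
  ... | tri≈ _ refl _ = top
  ... | tri> _ _ n′<j = above (+-monoʳ-< m n′<j)

-- The cyclic rotation m ↦ m+1 ↦ ⋯ ↦ m+n′ ↦ m of the block, fixing all other letters,
-- together with its inverse.
module Rotation (m n′ : ℕ) where

  ρ : ℕ → ℕ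
  ρ i = if i <ᵇ m then i else if i <ᵇ m + n′ then suc i else if i ≡ᵇ m + n′ then m else i

  ρ⁻¹ : ℕ → ℕ
  ρ⁻¹ i = if i <ᵇ m then i else if i ≡ᵇ m then m + n′ else if i <ᵇ suc (m + n′) then pred i else i

  ρ-below : ∀ {i} → i < m → ρ i ≡ i
  ρ-below i<m rewrite <ᵇ-true i<m = refl

  ρ-inside : ∀ {j} → j < n′ → ρ (m + j) ≡ m + suc j
  ρ-inside {j} j<n′ rewrite <ᵇ-false (m≤m+n m j) | <ᵇ-true (+-monoʳ-< m j<n′) = sym (+-suc m j)

  ρ-top : ρ (m + n′) ≡ m
  ρ-top rewrite <ᵇ-false (m≤m+n m n′) | <ᵇ-false (≤-refl {m + n′}) | ≡ᵇ-true {m + n′} refl = refl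

  ρ-above : ∀ {i} → m + n′ < i → ρ i ≡ i
  ρ-above {i} m+n′<i rewrite <ᵇ-false (≤-trans (m≤m+n m n′) (<⇒≤ m+n′<i)) | <ᵇ-false (<⇒≤ m+n′<i)
                           | ≡ᵇ-false (>⇒≢ m+n′<i) = refl

  ρ⁻¹-below : ∀ {i} → i < m → ρ⁻¹ i ≡ i
  ρ⁻¹-below i<m rewrite <ᵇ-true i<m = refl

  ρ⁻¹-inside : ∀ {j} → j < n′ → ρ⁻¹ (m + suc j) ≡ m + j
  ρ⁻¹-inside {j} j<n′ rewrite +-suc m j | <ᵇ-false (m≤n⇒m≤1+n (m≤m+n m j)) | ≡ᵇ-false (>⇒≢ (s≤s (m≤m+n m j)))
                            | <ᵇ-true (s<s (+-monoʳ-< m j<n′)) = refl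

  ρ⁻¹-bottom : ρ⁻¹ m ≡ m + n′
  ρ⁻¹-bottom rewrite <ᵇ-false (≤-refl {m}) | ≡ᵇ-true {m} refl = refl

  ρ⁻¹-above : ∀ {i} → m + n′ < i → ρ⁻¹ i ≡ i
  ρ⁻¹-above {i} m+n′<i rewrite <ᵇ-false (≤-trans (m≤m+n m n′) (<⇒≤ m+n′<i))
                             | ≡ᵇ-false (>⇒≢ (≤-<-trans (m≤m+n m n′) m+n′<i)) | <ᵇ-false m+n′<i = refl

  ρ⁻¹∘ρ : ∀ i → ρ⁻¹ (ρ i) ≡ i
  ρ⁻¹∘ρ i with region m n′ i
  ... | below i<m      rewrite ρ-below i<m      = ρ⁻¹-below i<m
  ... | inside j j<n′  rewrite ρ-inside j<n′    = ρ⁻¹-inside j<n′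
  ... | top            rewrite ρ-top            = ρ⁻¹-bottom
  ... | above m+n′<i   rewrite ρ-above m+n′<i   = ρ⁻¹-above m+n′<i

  ρ-injective : ∀ a b → ρ a ≡ ρ b → a ≡ b
  ρ-injective a b ρa≡ρb = trans (sym (ρ⁻¹∘ρ a)) (trans (cong ρ⁻¹ ρa≡ρb) (ρ⁻¹∘ρ b))

  ∑-ρ : ∀ f → ∑ (m + suc n′) (f ∘ ρ) ≡ ∑ (m + suc n′) f
  ∑-ρ f = begin
      ∑ (m + suc n′) (f ∘ ρ)
    ≡⟨ ∑-split m (suc n′) (f ∘ ρ) ⟩
      ∑ m (f ∘ ρ) + ∑ (suc n′) (λ j → f (ρ (m + j)))
    ≡⟨ cong₂ _+_ (∑-cong m (λ a a<m → cong f (ρ-below a<m))) (∑-last n′ _) ⟩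
      ∑ m f + (∑ n′ (λ j → f (ρ (m + j))) + f (ρ (m + n′)))
    ≡⟨ cong₂ (λ s t → ∑ m f + (s + f t)) (∑-cong n′ (λ j j<n′ → cong f (ρ-inside j<n′))) ρ-top ⟩
      ∑ m f + (∑ n′ (λ j → f (m + suc j)) + f m)
    ≡⟨ cong (∑ m f +_) (trans (+-comm _ (f m)) (cong (λ z → f z + ∑ n′ (λ j → f (m + suc j))) (sym (+-identityʳ m)))) ⟩
      ∑ m f + ∑ (suc n′) (λ j → f (m + j))
    ≡⟨ sym (∑-split m (suc n′) f) ⟩
      ∑ (m + suc n′) f
    ∎
    where open ≡-Reasoning

  ρ-base : ∀ w k → All (_< m) w →
    map ρ (w ++ base m (replicate (suc n′) k)) ↭ w ++ base m (replicate (suc n′) k)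
  ρ-base w k w<m = subst (_↭ w ++ base m (replicate (suc n′) k)) (sym rotated)
    (↭-++⁺ˡ w (↭-++-comm (base (suc m) (replicate n′ k)) (replicate k m)))
    where
    rotated : map ρ (w ++ base m (replicate (suc n′) k)) ≡ w ++ (base (suc m) (replicate n′ k) ++ replicate k m)
    rotated rewrite map-++ ρ w (base m (replicate (suc n′) k))
                  | map-id-local (All.map ρ-below w<m)
                  | base-replicate-∷ʳ m n′ k
                  | map-++ ρ (base m (replicate n′ k)) (replicate k (m + n′))
                  | base-replicate-suc ρ m n′ k (λ j j<n′ → trans (ρ-inside j<n′) (+-suc m j))
                  | map-replicate ρ k (m + n′) | ρ-top
                  = refl

  ρ-content : ∀ (c : ℕ → ℕ) k → (∀ j → j < suc n′ → c (m + j) ≡ k) → ∀ i → i < m + suc n′ → c (ρ i) ≡ c i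
  ρ-content c k c-block i i<r with region m n′ i
  ... | below i<m    = cong c (ρ-below i<m)
  ... | inside j j<n′ rewrite ρ-inside j<n′ = trans (c-block (suc j) (s<s j<n′)) (sym (c-block j (m<n⇒m<1+n j<n′)))
  ... | top          rewrite ρ-top = trans (cong c (sym (+-identityʳ m))) (trans (c-block 0 z<s) (sym (c-block n′ ≤-refl)))
  ... | above m+n′<i = ⊥-elim (<⇒≱ i<r (subst (_≤ i) (sym (+-suc m n′)) m+n′<i))

-- The alphabet {0, …, m + n′}: letters below m carry arbitrary multiplicities, while the
-- N = n′ + 1 letters m, …, m + n′ form a block in which every letter occurs k times.
module Block (m n′ k : ℕ) where
  open Rotation m n′

  N : ℕ
  N = suc n′

  r : ℕ
  r = m + N

  B : List ℕ
  B = base m (replicate N k)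

  below-m : (ℕ → ℕ) → ℕ → ℕ
  below-m c i = if i <ᵇ m then c i else 0

  blockContent : ℕ → ℕ
  blockContent i = if i <ᵇ m then 0 else k

  BlockFull : (ℕ → ℕ) → Set
  BlockFull c = ∀ j → j < N → c (m + j) ≡ k

  full-at : ∀ {c} → BlockFull c → ∀ i → m ≤ i → i < r → c i ≡ k
  full-at {c} full i m≤i i<r = trans (cong c (sym (m+[n∸m]≡n m≤i)))
    (full (i ∸ m) (+-cancelˡ-< m _ _ (subst (_< r) (sym (m+[n∸m]≡n m≤i)) i<r)))

  ⊖-full : ∀ {c} a → a < m → BlockFull c → BlockFull (c ⊖ a)
  ⊖-full {c} a a<m full j j<N rewrite ≡ᵇ-false (>⇒≢ (<-≤-trans a<m (m≤m+n m j))) = full j j<N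

  -- Any two letters of the block are interchangeable: the rotation ρ fixes w ++ B up to
  -- rearrangement and fixes c, while moving m + j to m + j + 1.
  block-step : ∀ w c → All (_< m) w → BlockFull c → ∀ j → j < n′ →
    D r (w ++ B) (c ⊖ (m + suc j)) ≡ D r (w ++ B) (c ⊖ (m + j))
  block-step w c w<m full j j<n′ = begin
      D r W (c ⊖ (m + suc j))
    ≡⟨ D-perm r (↭-sym (ρ-base w k w<m)) _ ⟩
      D r (map ρ W) (c ⊖ (m + suc j))
    ≡⟨ cong (λ l → D r (map ρ W) (c ⊖ l)) (sym (ρ-inside j<n′)) ⟩
      D r (map ρ W) (c ⊖ ρ (m + j))
    ≡⟨ D-relabel r ρ ρ-injective ∑-ρ W _ ⟩
      D r W ((c ⊖ ρ (m + j)) ∘ ρ)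
    ≡⟨ D-cong r W (λ i i<r → trans (⊖-rename ρ ρ-injective c (m + j) i)
                                   (⊖-cong r (m + j) (ρ-content c k full) i i<r)) ⟩
      D r W (c ⊖ (m + j))
    ∎
    where
    open ≡-Reasoning
    W = w ++ B

  block-equal : ∀ w c → All (_< m) w → BlockFull c → ∀ j → j < N →
    D r (w ++ B) (c ⊖ (m + j)) ≡ D r (w ++ B) (c ⊖ (m + 0))
  block-equal w c w<m full zero    _         = refl
  block-equal w c w<m full (suc j) (s<s j<n′) =
    trans (block-step w c w<m full j j<n′) (block-equal w c w<m full j (m<n⇒m<1+n j<n′))

  below-m-high : ∀ (c : ℕ → ℕ) j → below-m c (m + j) ≡ 0
  below-m-high c j rewrite <ᵇ-false (m≤m+n m j) = refl

  below-m-low : ∀ (c : ℕ → ℕ) {a} → a < m → below-m c a ≡ c a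
  below-m-low c a<m rewrite <ᵇ-true a<m = refl

  below-m-⊖ : ∀ (c : ℕ → ℕ) a i → (below-m c ⊖ a) i ≡ below-m (c ⊖ a) i
  below-m-⊖ c a i with i <ᵇ m | i ≡ᵇ a
  ... | true  | true  = refl
  ... | true  | false = refl
  ... | false | true  = refl
  ... | false | false = refl

  ∑-below-m : ∀ c → ∑ r (below-m c) ≡ ∑ m c
  ∑-below-m c = trans (∑-truncate m N (below-m c) (λ j _ → below-m-high c j)) (∑-cong m (λ a a<m → below-m-low c a<m))

  block-alone : ∀ c → BlockFull c → D r B c ≡ D r [] (below-m c) * D r B blockContent
  block-alone c full = begin
      D r B c
    ≡⟨ by-content ⟩
      when (∑ m c ≡ᵇ 0) 1 * D r B blockContent
    ≡⟨ cong (λ s → when (s ≡ᵇ 0) 1 * D r B blockContent) (sym (∑-below-m c)) ⟩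
      D r [] (below-m c) * D r B blockContent
    ∎
    where
    open ≡-Reasoning
    by-content : D r B c ≡ when (∑ m c ≡ᵇ 0) 1 * D r B blockContent
    by-content with ∑ m c ≟ 0
    ... | yes ∑≡0 rewrite ≡ᵇ-true ∑≡0 = trans (D-cong r B agree) (sym (+-identityʳ _))
      where
      agree : ∀ i → i < r → c i ≡ blockContent i
      agree i i<r with i <? m
      ... | yes i<m rewrite <ᵇ-true i<m = ∑≡0⇒ m c ∑≡0 i i<m
      ... | no  i≮m rewrite <ᵇ-false (≮⇒≥ i≮m) = full-at {c} full i (≮⇒≥ i≮m) i<r
    ... | no  ∑≢0 rewrite ≡ᵇ-false ∑≢0 = D-vanishes r B c too-long
      where
      too-long : ∑ r c ≢ length B
      too-long ∑≡len = ∑≢0 (+-cancelʳ-≡ (N * k) (∑ m c) 0 (begin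
          ∑ m c + N * k                       ≡⟨ cong (∑ m c +_) (sym (trans (∑-cong N full) (∑-const N k))) ⟩
          ∑ m c + ∑ N (λ j → c (m + j))       ≡⟨ sym (∑-split m N c) ⟩
          ∑ r c                               ≡⟨ ∑≡len ⟩
          length B                            ≡⟨ trans (length-base m (replicate N k)) (sum-replicate N k) ⟩
          N * k                               ∎))

  -- When the first position carries a letter x < m, the N choices of a block letter there
  -- all contribute the same amount, so together they contribute a multiple of N.
  block-letters : 1 ≤ k → ∀ x w c → x < m → All (_< m) w → BlockFull c →
    ∑ N (λ j → when (allowed x c (m + j)) (D r (w ++ B) (c ⊖ (m + j)))) ≡ D r (w ++ B) (c ⊖ (m + 0)) * N
  block-letters 1≤k x w c x<m w<m full = trans (∑-cong N same-term) (trans (∑-const N _) (*-comm N _))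
    where
    same-term : ∀ j → j < N → when (allowed x c (m + j)) (D r (w ++ B) (c ⊖ (m + j))) ≡ D r (w ++ B) (c ⊖ (m + 0))
    same-term j j<N rewrite ≡ᵇ-false (>⇒≢ (<-≤-trans x<m (m≤m+n m j))) | full j j<N | <ᵇ-true 1≤k =
      block-equal w c w<m full j j<N

  low-letters : ∀ x w c → D r (x ∷ w) (below-m c) * D r B blockContent
                        ≡ ∑ m (λ a → when (allowed x c a) (D r w (below-m (c ⊖ a)) * D r B blockContent))
  low-letters x w c = begin
      ∑ r term * GB
    ≡⟨ cong (_* GB) (∑-truncate m N term (λ j _ → unavailable x (below-m c) (m + j) (below-m-high c j))) ⟩
      ∑ m term * GB
    ≡⟨ ∑-*ʳ m term GB ⟩
      ∑ m (λ a → term a * GB)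
    ≡⟨ ∑-cong m (λ a a<m → trans (when-* (allowed x (below-m c) a) _ GB) (low a a<m)) ⟩
      ∑ m (λ a → when (allowed x c a) (D r w (below-m (c ⊖ a)) * GB))
    ∎
    where
    open ≡-Reasoning
    GB = D r B blockContent
    term = λ a → when (allowed x (below-m c) a) (D r w (below-m c ⊖ a))
    low : ∀ a → a < m → when (allowed x (below-m c) a) (D r w (below-m c ⊖ a) * GB)
                      ≡ when (allowed x c a) (D r w (below-m (c ⊖ a)) * GB)
    low a a<m rewrite below-m-low c a<m | D-cong r w (λ i _ → below-m-⊖ c a i) = refl

  factor-% : 1 ≤ k → ∀ w c → All (_< m) w → BlockFull c →
    D r (w ++ B) c % N ≡ (D r w (below-m c) * D r B blockContent) % N
  factor-% 1≤k []      c []            full = cong (_% N) (block-alone c full)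
  factor-% 1≤k (x ∷ w) c (x<m ∷ w<m)  full = begin
      ∑ r term % N
    ≡⟨ cong (_% N) (∑-split m N term) ⟩
      (∑ m term + ∑ N (λ j → term (m + j))) % N
    ≡⟨ cong (λ z → (∑ m term + z) % N) (block-letters 1≤k x w c x<m w<m full) ⟩
      (∑ m term + D r (w ++ B) (c ⊖ (m + 0)) * N) % N
    ≡⟨ [m+kn]%n≡m%n (∑ m term) (D r (w ++ B) (c ⊖ (m + 0))) N ⟩
      ∑ m term % N
    ≡⟨ ∑-cong-% N m low ⟩
      ∑ m (λ a → when (allowed x c a) (D r w (below-m (c ⊖ a)) * GB)) % N
    ≡⟨ cong (_% N) (sym (low-letters x w c)) ⟩
      (D r (x ∷ w) (below-m c) * GB) % N
    ∎
    where
    open ≡-Reasoning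
    GB = D r B blockContent
    term = λ a → when (allowed x c a) (D r (w ++ B) (c ⊖ a))
    low : ∀ a → a < m → term a % N ≡ when (allowed x c a) (D r w (below-m (c ⊖ a)) * GB) % N
    low a a<m with allowed x c a
    ... | false = refl
    ... | true  = factor-% 1≤k w (c ⊖ a) w<m (⊖-full {c} a a<m full)

content-++-low : ∀ s u i → i < length s → content (s ++ u) i ≡ content s i
content-++-low (x ∷ s) u zero    _         = refl
content-++-low (x ∷ s) u (suc i) (s<s i<n) = content-++-low s u i i<n

content-++-high : ∀ s u j → content (s ++ u) (length s + j) ≡ content u j
content-++-high []      u j = refl
content-++-high (x ∷ s) u j = content-++-high s u j

content-beyond : ∀ s i → length s ≤ i → content s i ≡ 0
content-beyond []      i       _         = refl
content-beyond (x ∷ s) (suc i) (s≤s n≤i) = content-beyond s i n≤i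

content-replicate : ∀ n k j → j < n → content (replicate n k) j ≡ k
content-replicate (suc n) k zero    _         = refl
content-replicate (suc n) k (suc j) (s<s j<n) = content-replicate n k j j<n

module Concatenation (t : List ℕ) (n′ k : ℕ) where
  open Block (length t) n′ k

  u : List ℕ
  u = replicate N k

  c : ℕ → ℕ
  c = content (t ++ u)

  c-full : BlockFull c
  c-full j j<N = trans (content-++-high t u j) (content-replicate N k j j<N)

  -- The factor for the letters below length t is P′ t: the block letters are absent there.
  t-factor : D r (base 0 t) (below-m c) ≡ P′ t
  t-factor = begin
      D r (base 0 t) (below-m c)
    ≡⟨ D-cong r (base 0 t) restrict ⟩
      D r (base 0 t) (content t)
    ≡⟨ D-extend (length t) N (base 0 t) (content t) (λ j _ → content-beyond t (length t + j) (m≤m+n (length t) j)) ⟩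
      D (length t) (base 0 t) (content t)
    ≡⟨ sym (P′≡D t) ⟩
      P′ t
    ∎
    where
    open ≡-Reasoning
    restrict : ∀ i → i < r → below-m c i ≡ content t i
    restrict i _ with i <? length t
    ... | yes i<L rewrite <ᵇ-true i<L = content-++-low t u i i<L
    ... | no  i≮L rewrite <ᵇ-false (≮⇒≥ i≮L) = sym (content-beyond t i (≮⇒≥ i≮L))

  -- The factor for the block is P′ u: the letters below length t are absent there.
  u-factor : D r B blockContent ≡ P′ u
  u-factor = begin
      D r B blockContent
    ≡⟨ cong (λ w → D r w blockContent)
            (trans (cong (λ o → base o u) (sym (+-identityʳ (length t)))) (sym (base-shift (length t) 0 u))) ⟩
      D r (map (length t +_) (base 0 u)) blockContent
    ≡⟨ D-shift (length t) N (base 0 u) blockContent (λ a a<L → cong (λ b → if b then 0 else k) (<ᵇ-true a<L)) ⟩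
      D N (base 0 u) (λ j → blockContent (length t + j))
    ≡⟨ D-cong N (base 0 u) (λ j j<N → trans (cong (λ b → if b then 0 else k) (<ᵇ-false (m≤m+n (length t) j)))
                                             (sym (content-replicate N k j j<N))) ⟩
      D N (base 0 u) (content u)
    ≡⟨ sym (trans (P′≡D u) (cong (λ len → D len (base 0 u) (content u)) (length-replicate N))) ⟩
      P′ u
    ∎
    where open ≡-Reasoning

  P′-++-% : 1 ≤ k → P′ (t ++ u) % N ≡ (P′ t * P′ u) % N
  P′-++-% 1≤k = begin
      P′ (t ++ u) % N
    ≡⟨ cong (_% N) (P′≡D (t ++ u)) ⟩
      D (length (t ++ u)) (base 0 (t ++ u)) c % N
    ≡⟨ cong₂ (λ len w → D len w c % N) (trans (length-++ t) (cong (length t +_) (length-replicate N))) (base-++ 0 t u) ⟩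
      D r (base 0 t ++ B) c % N
    ≡⟨ factor-% 1≤k (base 0 t) c (base-bounded 0 t) c-full ⟩
      (D r (base 0 t) (below-m c) * D r B blockContent) % N
    ≡⟨ cong₂ (λ p q → (p * q) % N) t-factor u-factor ⟩
      (P′ t * P′ u) % N
    ∎
    where open ≡-Reasoning

theorem5p3 : (m n k : ℕ) → 1 ≤ m → .{{_ : NonZero n}} → 1 ≤ k → (t : Vec ℕ m) →
    P′ (toList t ++ replicate n k) % n ≡ (P′ (toList t) * P′ (replicate n k)) % n
theorem5p3 m zero     k _ {{n≢0}} _   t = ⊥-elim (≢-nonZero⁻¹ 0 {{n≢0}} refl)
theorem5p3 m (suc n′) k _         1≤k t = Concatenation.P′-++-% (toList t) n′ k 1≤k
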